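{- There exists an integer $\Delta_0$ such that the following holds for every integer $\Delta\ge\Delta_0$. Let $D$ be a minimal counterexample for $\Delta$. If $uv$ is a simple arc of $D$, then $v$ has a simple out-neighbour and $u$ has a simple in-neighbour.
   Context: Digraphs are finite, without loops or parallel arcs (opposite arcs allowed). An arc $uv$ is simple if $vu$ is not an arc; $y$ is a simple out-neighbour of $x$ (and $x$ a simple in-neighbour of $y$) if $xy$ is a simple arc. $\tilde{\Delta}(D)=\max_v\sqrt{d^+(v)d^-(v)}$. $\vec{\chi}(D)$ is the least $k$ such that $V(D)$ can be partitioned into $k$ sets each inducing an acyclic subdigraph. $\overleftrightarrow{K}_n$ is the complete digraph on $n$ vertices, $\vec{C_3}$ the directed 3-cycle, $H_1\boxplus H_2$ is obtained from disjoint copies of $H_1,H_2$ by adding all arcs in both directions between them. For an integer $\Delta$, a minimal counterexample for $\Delta$ is a digraph $D$ with $\vec{\chi}(D)\geq\Delta\geq\tilde{\Delta}(D)$ that contains no subdigraph isomorphic to $\overleftrightarrow{K}_\Delta$ nor to $\vec{C_3}\boxplus\overleftrightarrow{K}_{\Delta-2}$, and such that $|V(D)|+|A(D)|$ is minimum among all digraphs with these properties. -}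

module Defs where

open import Data.Nat using (ℕ; zero; suc; _+_; _*_; _∸_; _≤_; _<_)
open import Data.Fin using (Fin; zero; suc; inject₁; fromℕ; _≟_)
open import Data.Fin.Patterns using (0F; 1F; 2F)
open import Data.Bool using (Bool; true; false; if_then_else_)
open import Data.List using (List; map; allFin)
open import Data.Nat.ListAction using (sum)
open import Data.Product using (Σ; ∃; ∃-syntax; _×_; _,_)
open import Data.Sum using (_⊎_; inj₁; inj₂)
open import Relation.Nullary using (¬_; yes; no)
open import Relation.Binary.PropositionalEquality using (_≡_)
open import Function.Definitions using (Injective)

-- A finite digraph on vertex set Fin n; adj u v ≡ true means uv is an arc.
-- Bool-valued adjacency: no parallel arcs; irreflexivity: no loops.
-- Opposite arcs are allowed.
record Digraph : Set where
  field
    n     : ℕ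
    adj   : Fin n → Fin n → Bool
    loopless : ∀ v → adj v v ≡ false
open Digraph public

Arc : (D : Digraph) → Fin (n D) → Fin (n D) → Set
Arc D u v = adj D u v ≡ true

SimpleArc : (D : Digraph) → Fin (n D) → Fin (n D) → Set
SimpleArc D u v = (adj D u v ≡ true) × (adj D v u ≡ false)

count : {m : ℕ} → (Fin m → Bool) → ℕ
count {m} p = sum (map (λ i → if p i then 1 else 0) (allFin m))

outdeg : (D : Digraph) → Fin (n D) → ℕ
outdeg D v = count (λ w → adj D v w)

indeg : (D : Digraph) → Fin (n D) → ℕ
indeg D v = count (λ w → adj D w v)

arcCount : Digraph → ℕ
arcCount D = sum (map (λ u → outdeg D u) (allFin (n D)))

size : Digraph → ℕ
size D = n D + arcCount D

-- Δ̃(D) ≤ Δ, i.e. max_v sqrt(d⁺(v) d⁻(v)) ≤ Δ, written for Δ ∈ ℕ as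
-- d⁺(v) * d⁻(v) ≤ Δ² for every vertex v.
MaxDegTildeAtMost : Digraph → ℕ → Set
MaxDegTildeAtMost D Δ = ∀ v → outdeg D v * indeg D v ≤ Δ * Δ

-- A directed cycle of D all of whose vertices lie in S: distinct vertices
-- x₀,…,x_m (m ≥ 1, so length ≥ 2) with arcs x_i x_{i+1} and x_m x_0.
record Cycle (D : Digraph) (S : Fin (n D) → Set) : Set where
  field
    m     : ℕ
    1≤m   : 1 ≤ m
    vtx   : Fin (suc m) → Fin (n D)
    inj   : Injective _≡_ _≡_ vtx
    step  : ∀ (i : Fin m) → Arc D (vtx (inject₁ i)) (vtx (suc i))
    close : Arc D (vtx (fromℕ m)) (vtx zero)
    inS   : ∀ i → S (vtx i)

Acyclic : (D : Digraph) → (Fin (n D) → Set) → Set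
Acyclic D S = ¬ Cycle D S

-- V(D) can be partitioned into k sets each inducing an acyclic subdigraph
-- (a partition into k possibly empty classes, given by a colouring).
AcyclicColourable : Digraph → ℕ → Set
AcyclicColourable D k =
  Σ (Fin (n D) → Fin k) λ c → ∀ (i : Fin k) → Acyclic D (λ v → c v ≡ i)

DichromaticAtLeast : Digraph → ℕ → Set
DichromaticAtLeast D Δ = ∀ k → k < Δ → ¬ AcyclicColourable D k

-- D contains a subdigraph isomorphic to H (not necessarily induced):
-- an injective vertex map sending arcs of H to arcs of D.
ContainsSub : (H D : Digraph) → Set
ContainsSub H D =
  Σ (Fin (n H) → Fin (n D)) λ φ →
    Injective _≡_ _≡_ φ × (∀ x y → Arc H x y → Arc D (φ x) (φ y))

completeAdj : {k : ℕ} → Fin k → Fin k → Bool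
completeAdj i j with i ≟ j
... | yes _ = false
... | no _  = true

completeLoopless : {k : ℕ} → (v : Fin k) → completeAdj v v ≡ false
completeLoopless v with v ≟ v
... | yes _ = Relation.Binary.PropositionalEquality.refl
... | no ¬p = Data.Empty.⊥-elim (¬p Relation.Binary.PropositionalEquality.refl)
  where import Data.Empty

K↔ : ℕ → Digraph
K↔ k = record { n = k ; adj = completeAdj ; loopless = completeLoopless }

c3Adj : Fin 3 → Fin 3 → Bool
c3Adj 0F 1F = true
c3Adj 1F 2F = true
c3Adj 2F 0F = true
c3Adj _  _  = false

c3Loopless : (v : Fin 3) → c3Adj v v ≡ false
c3Loopless 0F = Relation.Binary.PropositionalEquality.refl
c3Loopless 1F = Relation.Binary.PropositionalEquality.refl
c3Loopless 2F = Relation.Binary.PropositionalEquality.refl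

C3 : Digraph
C3 = record { n = 3 ; adj = c3Adj ; loopless = c3Loopless }

-- H₁ ⊞ H₂ : disjoint union plus all arcs in both directions between the parts.
-- Vertex set Fin (n H₁ + n H₂), first n H₁ vertices from H₁.
module _ (H₁ H₂ : Digraph) where
  open import Data.Fin using (splitAt)

  boxAdj : Fin (n H₁ + n H₂) → Fin (n H₁ + n H₂) → Bool
  boxAdj x y with splitAt (n H₁) x | splitAt (n H₁) y
  ... | inj₁ a | inj₁ b = adj H₁ a b
  ... | inj₂ a | inj₂ b = adj H₂ a b
  ... | inj₁ _ | inj₂ _ = true
  ... | inj₂ _ | inj₁ _ = true

  boxLoopless : ∀ v → boxAdj v v ≡ false
  boxLoopless v with splitAt (n H₁) v
  ... | inj₁ a = loopless H₁ a
  ... | inj₂ a = loopless H₂ a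

_⊞_ : Digraph → Digraph → Digraph
H₁ ⊞ H₂ = record { n = n H₁ + n H₂ ; adj = boxAdj H₁ H₂ ; loopless = boxLoopless H₁ H₂ }

CounterexampleFor : ℕ → Digraph → Set
CounterexampleFor Δ D =
  DichromaticAtLeast D Δ × MaxDegTildeAtMost D Δ
  × ¬ ContainsSub (K↔ Δ) D × ¬ ContainsSub (C3 ⊞ K↔ (Δ ∸ 2)) D

MinimalCounterexample : ℕ → Digraph → Set
MinimalCounterexample Δ D =
  CounterexampleFor Δ D × (∀ (D' : Digraph) → CounterexampleFor Δ D' → size D ≤ size D')

{-# OPTIONS --safe #-}
module Submission where

-- Suppose v has no simple out-neighbour, so every out-neighbour z of v also
-- sends an arc back to v. Deleting the simple arc uv then destroys no cycle
-- inside any vertex set S: a cycle in S avoiding v does not use uv, and a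
-- cycle in S through v yields, with the successor z of v, the digon {v, z} in
-- S, which survives because vu is not an arc. Hence every acyclic colouring of
-- D − uv is one of D, and since deleting an arc keeps the degree bound and
-- creates no forbidden subdigraph, D − uv is a smaller counterexample. The case
-- of u is symmetric, using predecessors. No lower bound on Δ is needed.

open import Defs
open import Data.Bool using (Bool; true; false; _∧_; not; if_then_else_)
import Data.Bool.Properties as Bool
open import Data.Empty using (⊥-elim)
open import Data.Fin using (Fin; zero; suc; inject₁; fromℕ; _≟_)
open import Data.Fin.Properties using (any?)
open import Data.List using (List; []; _∷_; map; allFin)
open import Data.List.Membership.Propositional using (_∈_)
open import Data.List.Membership.Propositional.Properties using (∈-allFin)
open import Data.List.Relation.Unary.Any using (here; there)
import Data.Nat as ℕ
open import Data.Nat using (ℕ; _≥_; _∸_; _≤_; _<_; z≤n; s≤s)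
open import Data.Nat.ListAction using (sum)
open import Data.Nat.Properties
  using (≤-refl; ≤-trans; <-irrefl; ≤-<-trans; +-mono-≤; +-mono-≤-<; +-monoʳ-<; *-mono-≤)
open import Data.Product using (∃; ∃-syntax; _×_; _,_; proj₁; proj₂)
open import Data.Sum using (_⊎_; inj₁; inj₂)
open import Relation.Nullary using (¬_; Dec; yes; no; does; contradiction)
open import Relation.Nullary.Decidable using (_×-dec_; dec-true; dec-false)
open import Relation.Binary.PropositionalEquality using (_≡_; _≢_; refl; sym; trans; cong)

sum-map-mono-≤ : ∀ {A : Set} (xs : List A) {f g : A → ℕ} →
  (∀ x → f x ≤ g x) → sum (map f xs) ≤ sum (map g xs)
sum-map-mono-≤ []       f≤g = z≤n
sum-map-mono-≤ (x ∷ xs) f≤g = +-mono-≤ (f≤g x) (sum-map-mono-≤ xs f≤g)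

sum-map-mono-< : ∀ {A : Set} {xs : List A} {f g : A → ℕ} →
  (∀ x → f x ≤ g x) → ∀ {y} → y ∈ xs → f y < g y → sum (map f xs) < sum (map g xs)
sum-map-mono-< {xs = x ∷ xs} f≤g (here refl) fy<gy = +-mono-≤ fy<gy (sum-map-mono-≤ xs f≤g)
sum-map-mono-< {xs = x ∷ xs} f≤g (there y∈xs) fy<gy = +-mono-≤-< (f≤g x) (sum-map-mono-< f≤g y∈xs fy<gy)

indicator : Bool → ℕ
indicator b = if b then 1 else 0

indicator-mono : ∀ {a b} → (a ≡ true → b ≡ true) → indicator a ≤ indicator b
indicator-mono {false}         a⇒b = z≤n
indicator-mono {true}  {true}  a⇒b = ≤-refl
indicator-mono {true}  {false} a⇒b with a⇒b refl
... | ()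

module _ {m : ℕ} {p q : Fin m → Bool} (p⇒q : ∀ i → p i ≡ true → q i ≡ true) where

  count-mono-≤ : count p ≤ count q
  count-mono-≤ = sum-map-mono-≤ (allFin m) (λ i → indicator-mono (p⇒q i))

  count-mono-< : ∀ j → p j ≡ false → q j ≡ true → count p < count q
  count-mono-< j pj qj = sum-map-mono-< (λ i → indicator-mono (p⇒q i)) (∈-allFin j) indicator-j<
    where
    indicator-j< : indicator (p j) < indicator (q j)
    indicator-j< rewrite pj | qj = ≤-refl

keepArcs : (D : Digraph) → (Fin (n D) → Fin (n D) → Bool) → Digraph
keepArcs D keep = record
  { n = n D
  ; adj = λ x y → adj D x y ∧ keep x y
  ; loopless = λ x → cong (_∧ keep x x) (loopless D x)
  }

module _ (D : Digraph) (keep : Fin (n D) → Fin (n D) → Bool) where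

  private
    D′ = keepArcs D keep

  keepArcs-arc⇒arc : ∀ x y → Arc D′ x y → Arc D x y
  keepArcs-arc⇒arc x y = Bool.∧-conicalˡ (adj D x y) (keep x y)

  arc⇒keepArcs-arc : ∀ {x y} → Arc D x y → keep x y ≡ true → Arc D′ x y
  arc⇒keepArcs-arc xy keep-xy rewrite xy | keep-xy = refl

  outdeg-keepArcs-≤ : ∀ x → outdeg D′ x ≤ outdeg D x
  outdeg-keepArcs-≤ x = count-mono-≤ (keepArcs-arc⇒arc x)

  indeg-keepArcs-≤ : ∀ x → indeg D′ x ≤ indeg D x
  indeg-keepArcs-≤ x = count-mono-≤ (λ y → keepArcs-arc⇒arc y x)

  size-keepArcs-< : ∀ {u v} → Arc D u v → keep u v ≡ false → size D′ < size D
  size-keepArcs-< {u} {v} uv drop-uv =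
    +-monoʳ-< (n D) (sum-map-mono-< outdeg-keepArcs-≤ (∈-allFin u) outdeg-u<)
    where
    outdeg-u< : outdeg D′ u < outdeg D u
    outdeg-u< = count-mono-< (keepArcs-arc⇒arc u) v
      (trans (cong (adj D u v ∧_) drop-uv) (Bool.∧-zeroʳ (adj D u v))) uv

  keepArcs-MaxDegTildeAtMost : ∀ {Δ} → MaxDegTildeAtMost D Δ → MaxDegTildeAtMost D′ Δ
  keepArcs-MaxDegTildeAtMost bound x =
    ≤-trans (*-mono-≤ (outdeg-keepArcs-≤ x) (indeg-keepArcs-≤ x)) (bound x)

  keepArcs-ContainsSub : ∀ {H} → ContainsSub H D′ → ContainsSub H D
  keepArcs-ContainsSub (φ , φ-inj , φ-arc) =
    φ , φ-inj , λ x y xy → keepArcs-arc⇒arc (φ x) (φ y) (φ-arc x y xy)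

  keepArcs-Cycle : ∀ {S} (C : Cycle D S) →
    (∀ i j → keep (Cycle.vtx C i) (Cycle.vtx C j) ≡ true) → Cycle D′ S
  keepArcs-Cycle C kept = record
    { m = m ; 1≤m = 1≤m ; vtx = vtx ; inj = inj ; inS = inS
    ; step  = λ i → arc⇒keepArcs-arc (step i) (kept _ _)
    ; close = arc⇒keepArcs-arc close (kept _ _)
    }
    where open Cycle C

  keepArcs-CounterexampleFor : ∀ {Δ} → (∀ {S} → Cycle D S → Cycle D′ S) →
    CounterexampleFor Δ D → CounterexampleFor Δ D′
  keepArcs-CounterexampleFor {Δ} lift (χ≥Δ , bound , no-K , no-C3⊞K) =
      (λ k k<Δ (c , acyclic) → χ≥Δ k k<Δ (c , λ i C → acyclic i (lift C)))
    , keepArcs-MaxDegTildeAtMost {Δ} bound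
    , (λ sub → no-K (keepArcs-ContainsSub {K↔ Δ} sub))
    , (λ sub → no-C3⊞K (keepArcs-ContainsSub {C3 ⊞ K↔ (Δ ∸ 2)} sub))

differsFrom : ∀ {m} → Fin m → Fin m → Fin m → Fin m → Bool
differsFrom u v x y = not (does ((x ≟ u) ×-dec (y ≟ v)))

differsFrom-true : ∀ {m} (u v x y : Fin m) → ¬ (x ≡ u × y ≡ v) → differsFrom u v x y ≡ true
differsFrom-true u v x y ≢uv = cong not (dec-false ((x ≟ u) ×-dec (y ≟ v)) ≢uv)

differsFrom-self : ∀ {m} (u v : Fin m) → differsFrom u v u v ≡ false
differsFrom-self u v = cong not (dec-true ((u ≟ u) ×-dec (v ≟ v)) (refl , refl))

deleteArc : (D : Digraph) → Fin (n D) → Fin (n D) → Digraph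
deleteArc D u v = keepArcs D (differsFrom u v)

minimal-counterexample-arc-critical : ∀ {Δ D u v} → MinimalCounterexample Δ D → Arc D u v →
  ¬ (∀ {S} → Cycle D S → Cycle (deleteArc D u v) S)
minimal-counterexample-arc-critical {Δ} {D} {u} {v} (counterexample , minimal) uv lift =
  <-irrefl refl (≤-<-trans (minimal (deleteArc D u v) counterexample′) smaller)
  where
  counterexample′ : CounterexampleFor Δ (deleteArc D u v)
  counterexample′ = keepArcs-CounterexampleFor D (differsFrom u v) lift counterexample

  smaller : size (deleteArc D u v) < size D
  smaller = size-keepArcs-< D (differsFrom u v) uv (differsFrom-self u v)

digon-cycle : ∀ {G : Digraph} {S : Fin (n G) → Set} {a b} →
  Arc G a b → Arc G b a → S a → S b → Cycle G S
digon-cycle {G} {S} {a} {b} ab ba Sa Sb = record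
  { m = 1 ; 1≤m = s≤s z≤n ; vtx = vtx ; inj = inj ; step = step ; close = ba ; inS = inS }
  where
  vtx : Fin 2 → Fin (n G)
  vtx zero       = a
  vtx (suc zero) = b

  a≢b : a ≢ b
  a≢b refl with trans (sym ab) (loopless G a)
  ... | ()

  inj : ∀ {i j} → vtx i ≡ vtx j → i ≡ j
  inj {zero}     {zero}     _ = refl
  inj {zero}     {suc zero} e = contradiction e a≢b
  inj {suc zero} {zero}     e = contradiction (sym e) a≢b
  inj {suc zero} {suc zero} _ = refl

  step : ∀ (i : Fin 1) → Arc G (vtx (inject₁ i)) (vtx (suc i))
  step zero = ab

  inS : ∀ i → S (vtx i)
  inS zero       = Sa
  inS (suc zero) = Sb

fromℕ-or-inject₁ : ∀ {m} (j : Fin (ℕ.suc m)) → j ≡ fromℕ m ⊎ ∃[ i ] j ≡ inject₁ i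
fromℕ-or-inject₁ {ℕ.zero}  zero  = inj₁ refl
fromℕ-or-inject₁ {ℕ.suc m} zero  = inj₂ (zero , refl)
fromℕ-or-inject₁ {ℕ.suc m} (suc j) with fromℕ-or-inject₁ j
... | inj₁ j≡last     = inj₁ (cong suc j≡last)
... | inj₂ (i , j≡i)  = inj₂ (suc i , cong suc j≡i)

module _ {G : Digraph} {S : Fin (n G) → Set} (C : Cycle G S) where
  open Cycle C

  cycle-successor : ∀ j → ∃[ j′ ] Arc G (vtx j) (vtx j′)
  cycle-successor j with fromℕ-or-inject₁ j
  ... | inj₁ refl       = zero , close
  ... | inj₂ (i , refl) = suc i , step i

  cycle-predecessor : ∀ j → ∃[ j′ ] Arc G (vtx j′) (vtx j)
  cycle-predecessor zero    = fromℕ m , close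
  cycle-predecessor (suc i) = inject₁ i , step i

module _ {D : Digraph} {u v : Fin (n D)} (uv-simple : SimpleArc D u v) where

  digon-arc-survives : ∀ {x z} → Arc D x z → Arc D z x → Arc (deleteArc D u v) x z
  digon-arc-survives {x} {z} xz zx =
    arc⇒keepArcs-arc D (differsFrom u v) xz (differsFrom-true u v x z λ { (refl , refl) →
      contradiction (trans (sym zx) (proj₂ uv-simple)) λ () })

  digon-cycle-survives : ∀ {S x z} → Arc D x z → Arc D z x → S x → S z →
    Cycle (deleteArc D u v) S
  digon-cycle-survives xz zx =
    digon-cycle (digon-arc-survives xz zx) (digon-arc-survives zx xz)

  cycle-avoiding-survives : ∀ {S} (C : Cycle D S) →
    (∀ i → Cycle.vtx C i ≢ u) ⊎ (∀ i → Cycle.vtx C i ≢ v) → Cycle (deleteArc D u v) S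
  cycle-avoiding-survives C (inj₁ ≢u) =
    keepArcs-Cycle D (differsFrom u v) C λ i j →
      differsFrom-true u v (Cycle.vtx C i) (Cycle.vtx C j) λ (x≡u , _) → ≢u i x≡u
  cycle-avoiding-survives C (inj₂ ≢v) =
    keepArcs-Cycle D (differsFrom u v) C λ i j →
      differsFrom-true u v (Cycle.vtx C i) (Cycle.vtx C j) λ (_ , y≡v) → ≢v j y≡v

  cycles-survive-if-out-arcs-doubled : (∀ z → Arc D v z → Arc D z v) →
    ∀ {S} → Cycle D S → Cycle (deleteArc D u v) S
  cycles-survive-if-out-arcs-doubled doubled C with any? (λ j → Cycle.vtx C j ≟ v)
  ... | no v∉C          = cycle-avoiding-survives C (inj₂ λ j e → v∉C (j , e))
  ... | yes (j , refl)  with cycle-successor C j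
  ...   | j′ , vz = digon-cycle-survives vz (doubled _ vz) (Cycle.inS C j) (Cycle.inS C j′)

  cycles-survive-if-in-arcs-doubled : (∀ z → Arc D z u → Arc D u z) →
    ∀ {S} → Cycle D S → Cycle (deleteArc D u v) S
  cycles-survive-if-in-arcs-doubled doubled C with any? (λ j → Cycle.vtx C j ≟ u)
  ... | no u∉C          = cycle-avoiding-survives C (inj₁ λ j e → u∉C (j , e))
  ... | yes (j , refl)  with cycle-predecessor C j
  ...   | j′ , zu = digon-cycle-survives (doubled _ zu) zu (Cycle.inS C j) (Cycle.inS C j′)

simpleArc? : (D : Digraph) → ∀ x y → Dec (SimpleArc D x y)
simpleArc? D x y = (adj D x y Bool.≟ true) ×-dec (adj D y x Bool.≟ false)

simple-out-neighbour-or-out-arcs-doubled : ∀ D v →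
  (∃[ w ] SimpleArc D v w) ⊎ (∀ z → Arc D v z → Arc D z v)
simple-out-neighbour-or-out-arcs-doubled D v with any? (simpleArc? D v)
... | yes simple = inj₁ simple
... | no ¬simple = inj₂ λ z vz → Bool.¬-not λ zv → ¬simple (z , vz , zv)

simple-in-neighbour-or-in-arcs-doubled : ∀ D u →
  (∃[ x ] SimpleArc D x u) ⊎ (∀ z → Arc D z u → Arc D u z)
simple-in-neighbour-or-in-arcs-doubled D u with any? (λ x → simpleArc? D x u)
... | yes simple = inj₁ simple
... | no ¬simple = inj₂ λ z zu → Bool.¬-not λ uz → ¬simple (z , zu , uz)

lemma4p2 : ∃[ Δ₀ ] ∀ (Δ : ℕ) → Δ ≥ Δ₀ → ∀ (D : Digraph) → MinimalCounterexample Δ D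
    → ∀ (u v : Fin (n D)) → SimpleArc D u v
    → (∃[ w ] SimpleArc D v w) × (∃[ x ] SimpleArc D x u)
lemma4p2 = 0 , λ Δ _ D minimal u v uv → simple-out D minimal uv , simple-in D minimal uv
  where
  simple-out : ∀ {Δ} D → MinimalCounterexample Δ D → ∀ {u v} → SimpleArc D u v →
    ∃[ w ] SimpleArc D v w
  simple-out D minimal {v = v} uv with simple-out-neighbour-or-out-arcs-doubled D v
  ... | inj₁ w       = w
  ... | inj₂ doubled = ⊥-elim (minimal-counterexample-arc-critical minimal (proj₁ uv)
                                 (cycles-survive-if-out-arcs-doubled uv doubled))

  simple-in : ∀ {Δ} D → MinimalCounterexample Δ D → ∀ {u v} → SimpleArc D u v →
    ∃[ x ] SimpleArc D x u
  simple-in D minimal {u} uv with simple-in-neighbour-or-in-arcs-doubled D u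
  ... | inj₁ x       = x
  ... | inj₂ doubled = ⊥-elim (minimal-counterexample-arc-critical minimal (proj₁ uv)
                                 (cycles-survive-if-in-arcs-doubled uv doubled))
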